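{- Let $r\ge1$ and $K$ a tame cyclic number field of degree $2^r$ with ramified primes $p_1,\dots,p_n$, ramification indices $e_{p_i}$ and $h_i=\frac{p_i-1}{e_{p_i}}$. In $\mathbb{Z}[G]$, $G=\mathrm{Gal}(K/\mathbb{Q})\cong\mathbb{Z}/2^r\mathbb{Z}$, let $I$ be the identity, $\sigma$ the unique element of order $2$, and $\Sigma_{\langle 2^j\rangle}$ the sum of the elements of the unique subgroup of order $2^j$. Put $Y'_i=I$ if $h_i$ is even and $Y'_i=\sigma$ if $h_i$ is odd, and let $\varepsilon$ be the number of $i$ with $h_i$ odd (i.e. with $e_{p_i}$ exactly dividing the $2$-part of $p_i-1$, written $e_{p_i}\,\|\,(p_i-1)$). For $1\le i\le r$ let $\mathbb{P}_i=\{p_k:e_{p_k}=2^i\}$, $m_i=\prod_{p\in\mathbb{P}_i}p$ (empty product $=1$), $f_i=\frac{m_i-1}{2^i}$. Then $$\prod_{k=1}^n\bigl(p_kY'_k-h_k\Sigma_{\langle e_{p_k}\rangle}\bigr)=a_0\sigma^{\varepsilon}+a_1\Sigma_{\langle 2\rangle}+\dots+a_r\Sigma_{\langle 2^r\rangle}$$ with $a_0=p_1\cdots p_n$ and $a_i=-f_i\prod_{j>i}m_j$ for $1\le i\le r$.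
   Context: A number field is tame if no prime ramifies wildly; cyclic of degree $n$ means Galois over $\mathbb{Q}$ with Galois group $\mathbb{Z}/n\mathbb{Z}$. For each ramified $p_k$, $e_{p_k}$ is a nontrivial power of $2$ dividing $p_k-1$, and $\Sigma_{\langle e_{p_k}\rangle}$ is the sum of the elements of the subgroup of $G$ of order $e_{p_k}$. -}

module Defs where

open import Data.Nat as ℕ using (ℕ; zero; suc; _∸_; _^_; _%_)
open import Data.Nat.Divisibility using (_∣_; _∣?_)
open import Data.Nat.DivMod using (_/_)
open import Data.Nat.Properties using (m^n≢0)
open import Data.Integer as ℤ using (ℤ; +_; -_)
open import Data.Fin using (Fin; toℕ)
open import Data.List using (List; allFin; map; foldr; filter)
open import Data.List using (length)
open import Data.Bool using (if_then_else_)
open import Relation.Nullary.Decidable using (does)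
open import Data.Nat using (_≟_)
open import Relation.Binary.PropositionalEquality using (_≡_)

-- The Galois group G ≅ ℤ/2^r ℤ is modelled as Fin (2 ^ r) with addition
-- mod 2^r; the group ring ℤ[G] as functions G → ℤ (with pointwise
-- equality used as the equality of the group ring).

Order : ℕ → ℕ
Order r = 2 ^ r

record ZG (r : ℕ) : Set where
  constructor mkZG
  field coeff : Fin (Order r) → ℤ
open ZG public

_≈G_ : ∀ {r} → ZG r → ZG r → Set
_≈G_ {r} x y = (g : Fin (Order r)) → coeff x g ≡ coeff y g

sumℤ : List ℤ → ℤ
sumℤ = foldr ℤ._+_ (+ 0)

prodℕ : List ℕ → ℕ
prodℕ = foldr ℕ._*_ 1

elt : (r : ℕ) → ℕ → ZG r
elt r a = mkZG λ g → if does (toℕ g ≟ (a % Order r) ⦃ m^n≢0 2 r ⦄) then + 1 else + 0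

_⊕_ : ∀ {r} → ZG r → ZG r → ZG r
x ⊕ y = mkZG λ g → coeff x g ℤ.+ coeff y g

_·_ : ∀ {r} → ℤ → ZG r → ZG r
c · x = mkZG λ g → c ℤ.* coeff x g

_⊛_ : ∀ {r} → ZG r → ZG r → ZG r
_⊛_ {r} x y = mkZG λ g →
  sumℤ (map (λ a → sumℤ (map (λ b →
    if does (((toℕ a ℕ.+ toℕ b) % Order r) ⦃ m^n≢0 2 r ⦄ ≟ toℕ g)
    then coeff x a ℤ.* coeff y b else + 0) (allFin (Order r)))) (allFin (Order r)))

idG : (r : ℕ) → ZG r
idG r = elt r 0

powG : ∀ {r} → ZG r → ℕ → ZG r
powG {r} x zero = idG r
powG {r} x (suc k) = x ⊛ powG x k

prodG : ∀ {r} → List (ZG r) → ZG r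
prodG {r} = foldr _⊛_ (idG r)

-- σ: the unique element of order 2 in ℤ/2^r (r ≥ 1), namely 2^(r-1)
sigmaG : (r : ℕ) → ZG r
sigmaG r = elt r (2 ^ (r ∸ 1))

-- Σ_{⟨2^j⟩}: sum of the elements of the unique subgroup of order 2^j
-- (j ≤ r), i.e. of the multiples of 2^(r-j)
SigmaSub : (r j : ℕ) → ZG r
SigmaSub r j = mkZG λ g → if does (2 ^ (r ∸ j) ∣? toℕ g) then + 1 else + 0

range1 : ℕ → List ℕ
range1 zero = Data.List.[]
range1 (suc r) = range1 r Data.List.++ Data.List.[ suc r ]

module Ramification (r n : ℕ) (p t : Fin n → ℕ) where

  e : Fin n → ℕ
  e k = 2 ^ t k

  h : Fin n → ℕ
  h k = ((p k ∸ 1) / e k) ⦃ m^n≢0 2 (t k) ⦄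

  isOdd : ℕ → Data.Bool.Bool
  isOdd m = does (m % 2 ≟ 1)

  Y' : Fin n → ZG r
  Y' k = if isOdd (h k) then sigmaG r else idG r

  ε : ℕ
  ε = length (filter (λ k → h k % 2 ≟ 1) (allFin n))

  m : ℕ → ℕ
  m i = prodℕ (map p (filter (λ k → t k ≟ i) (allFin n)))

  f : ℕ → ℕ
  f i = ((m i ∸ 1) / 2 ^ i) ⦃ m^n≢0 2 i ⦄

  a₀ : ℤ
  a₀ = + prodℕ (map p (allFin n))

  a : ℕ → ℤ
  a i = - (+ (f i ℕ.* prodℕ (map m (filter (λ j → i ℕ.<? j) (range1 r)))))

  LHS : ZG r
  LHS = prodG (map (λ k → ((+ p k) · Y' k) ⊕ ((- (+ h k)) · SigmaSub r (t k)))
                   (allFin n))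

  RHS : ZG r
  RHS = mkZG λ g → coeff (a₀ · powG (sigmaG r) ε) g
          ℤ.+ sumℤ (map (λ i → coeff (a i · SigmaSub r i) g) (range1 r))

{-# OPTIONS --safe #-}

-- Elements of ℤ[G], G = ℤ/2^r, are handled through their coefficient functions on residues
-- mod 2^r, so that products become convolutions.  Writing Sᵢ = Σ⟨2^i⟩, one has σ Sᵢ = Sᵢ for
-- i ≥ 1 and S_t Sᵢ = 2^min(t,i) S_max(t,i).  Hence the product over any sublist of the primes has
-- the shape A σ^ε + Σᵢ aᵢ Sᵢ, and multiplying it by p Y' − h S_t, where p = h 2^t + 1, replaces
-- aᵢ by p aᵢ for i < t, by p a_t − h M_t for i = t, and keeps aᵢ for i > t (Mᵢ = ∏_{j>i} m_j):
-- the term −h A S_t coming from A σ^ε is cancelled by the telescoping sum Σ_{i≤t} aᵢ 2^i = M_t − A.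
-- These are exactly the recurrences satisfied by A = ∏ p and aᵢ = −fᵢ Mᵢ when a prime is added.

module Submission where

open import Defs
open import Data.Nat using (ℕ; _≤_; _∸_; _^_)
open import Data.Nat.Divisibility using (_∣_)
open import Data.Nat.Primality using (Prime)
open import Data.Fin using (Fin)
open import Function.Definitions using (Injective)
open import Relation.Binary.PropositionalEquality using (_≡_)

open import Data.Nat as ℕ using (zero; suc; _<_; _%_; _<?_; _≤?_; z≤n; s≤s; NonZero)
open import Data.Nat.Properties as ℕₚ using (m^n≢0)
open import Data.Nat.Primality using (prime⇒nonZero)
open import Data.Nat.Divisibility
  using (divides; _∣?_; _∣0; ∣-refl; ∣-trans; ∣⇒≤; ∣m∣n⇒∣m+n; ∣m+n∣m⇒∣n; ∣m⇒∣m*n; ∣n∣m%n⇒∣m; %-presˡ-∣)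
open import Data.Integer using (ℤ; +_; -_; _+_; _*_; _-_)
import Data.Integer.Properties as ℤₚ
open import Data.Integer.Solver using (module +-*-Solver)
open import Data.Fin using (toℕ)
open import Data.Fin.Properties using (toℕ<n)
open import Data.Nat.DivMod
  using (_/_; 0/n≡0; m/n*n≡m; m*n/n≡m; m%n<n; m%n%n≡m%n; %-distribˡ-+; [m+n]%n≡m%n; m<n⇒m%n≡m)
open import Data.List using (List; []; _∷_; _++_; map; filter; length; allFin; tabulate)
open import Data.List.Properties using (map-tabulate; map-++; filter-++; filter-accept; filter-reject)
open import Data.Nat.ListAction.Properties using (product-++)
import Data.Fin as Fin
open import Data.Bool using (true; false; if_then_else_)
open import Function using (_∘_; _⇔_; mk⇔)
open import Data.Sum using (inj₁; inj₂)
open import Relation.Binary.Definitions using (tri<; tri≈; tri>)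
open import Data.Product using (_×_; _,_; proj₁)
open import Relation.Nullary using (Dec; yes; no; does; ¬_)
open import Relation.Nullary.Decidable using (dec-true; dec-false; does-⇔)
open import Relation.Binary.PropositionalEquality
  using (refl; sym; trans; cong; cong₂; subst; _≢_; module ≡-Reasoning)
open +-*-Solver using (solve; _:+_; _:*_; :-_; _:-_; _:=_; con)

-- Indicators and finite sums

𝟙 : ∀ {A : Set} → Dec A → ℤ
𝟙 a? = if does a? then + 1 else + 0

𝟙-yes : ∀ {A : Set} (a? : Dec A) → A → 𝟙 a? ≡ + 1
𝟙-yes a? a rewrite dec-true a? a = refl

𝟙-no : ∀ {A : Set} (a? : Dec A) → ¬ A → 𝟙 a? ≡ + 0
𝟙-no a? ¬a rewrite dec-false a? ¬a = refl

𝟙*-cong : ∀ {A : Set} (a? : Dec A) {u v : ℤ} → (A → u ≡ v) → 𝟙 a? * u ≡ 𝟙 a? * v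
𝟙*-cong (yes a) u≡v = cong (+ 1 *_) (u≡v a)
𝟙*-cong (no _)  _   = refl

*𝟙-cong : ∀ {A : Set} (a? : Dec A) {u v : ℤ} → (A → u ≡ v) → u * 𝟙 a? ≡ v * 𝟙 a?
*𝟙-cong a? {u} {v} u≡v = trans (ℤₚ.*-comm u (𝟙 a?)) (trans (𝟙*-cong a? u≡v) (ℤₚ.*-comm (𝟙 a?) v))

if-then-0 : ∀ b (w : ℤ) → (if b then w else + 0) ≡ (if b then + 1 else + 0) * w
if-then-0 true  w = sym (ℤₚ.*-identityˡ w)
if-then-0 false w = refl

𝟙-⇔ : ∀ {A B : Set} → A ⇔ B → (a? : Dec A) (b? : Dec B) → 𝟙 a? ≡ 𝟙 b?
𝟙-⇔ A⇔B a? b? = cong (if_then + 1 else + 0) (does-⇔ A⇔B a? b?)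

∑< : ℕ → (ℕ → ℤ) → ℤ
∑< zero    F = + 0
∑< (suc n) F = F 0 + ∑< n (F ∘ suc)

∑<-cong : ∀ n {F G : ℕ → ℤ} → (∀ a → a < n → F a ≡ G a) → ∑< n F ≡ ∑< n G
∑<-cong zero    F≡G = refl
∑<-cong (suc n) F≡G = cong₂ _+_ (F≡G 0 (s≤s z≤n)) (∑<-cong n (λ a a<n → F≡G (suc a) (s≤s a<n)))

∑<-zero : ∀ n → ∑< n (λ _ → + 0) ≡ + 0
∑<-zero zero    = refl
∑<-zero (suc n) = trans (ℤₚ.+-identityˡ _) (∑<-zero n)

∑<-distrib-+ : ∀ n (F G : ℕ → ℤ) → ∑< n (λ a → F a + G a) ≡ ∑< n F + ∑< n G
∑<-distrib-+ zero    F G = refl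
∑<-distrib-+ (suc n) F G rewrite ∑<-distrib-+ n (F ∘ suc) (G ∘ suc) =
  solve 4 (λ a b c d → (a :+ b) :+ (c :+ d) := (a :+ c) :+ (b :+ d)) refl (F 0) (G 0) _ _

*-distribˡ-∑< : ∀ n c (F : ℕ → ℤ) → c * ∑< n F ≡ ∑< n (λ a → c * F a)
*-distribˡ-∑< zero    c F = ℤₚ.*-zeroʳ c
*-distribˡ-∑< (suc n) c F =
  trans (ℤₚ.*-distribˡ-+ c (F 0) _) (cong (λ z → c * F 0 + z) (*-distribˡ-∑< n c (F ∘ suc)))

∑<-+ : ∀ m n (F : ℕ → ℤ) → ∑< (m ℕ.+ n) F ≡ ∑< m F + ∑< n (λ a → F (m ℕ.+ a))
∑<-+ zero    n F = sym (ℤₚ.+-identityˡ _)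
∑<-+ (suc m) n F rewrite ∑<-+ m n (F ∘ suc) = sym (ℤₚ.+-assoc (F 0) _ _)

∑<-init-last : ∀ n (F : ℕ → ℤ) → ∑< (suc n) F ≡ ∑< n F + F n
∑<-init-last n F = begin
  ∑< (suc n) F
    ≡⟨ cong (λ m → ∑< m F) (ℕₚ.+-comm 1 n) ⟩
  ∑< (n ℕ.+ 1) F
    ≡⟨ ∑<-+ n 1 F ⟩
  ∑< n F + (F (n ℕ.+ 0) + + 0)
    ≡⟨ cong (λ z → ∑< n F + z) (trans (ℤₚ.+-identityʳ _) (cong F (ℕₚ.+-identityʳ n))) ⟩
  ∑< n F + F n
    ∎
  where open ≡-Reasoning

∑<-reverse : ∀ n (F : ℕ → ℤ) → ∑< n F ≡ ∑< n (λ a → F (n ∸ suc a))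
∑<-reverse zero    F = refl
∑<-reverse (suc n) F = begin
  F 0 + ∑< n (F ∘ suc)
    ≡⟨ cong (λ z → F 0 + z) (∑<-reverse n (F ∘ suc)) ⟩
  F 0 + ∑< n (λ a → F (suc (n ∸ suc a)))
    ≡⟨ cong (λ z → F 0 + z) (∑<-cong n (λ a a<n → cong F (sym (ℕₚ.+-∸-assoc 1 a<n)))) ⟩
  F 0 + ∑< n (λ a → F (suc n ∸ suc a))
    ≡⟨ ℤₚ.+-comm (F 0) _ ⟩
  ∑< n (λ a → F (suc n ∸ suc a)) + F 0
    ≡⟨ cong (λ m → ∑< n (λ a → F (suc n ∸ suc a)) + F m) (ℕₚ.n∸n≡0 n) ⟨
  ∑< n (λ a → F (suc n ∸ suc a)) + F (suc n ∸ suc n)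
    ≡⟨ ∑<-init-last n (λ a → F (suc n ∸ suc a)) ⟨
  ∑< (suc n) (λ a → F (suc n ∸ suc a))
    ∎
  where open ≡-Reasoning

∑<-comm : ∀ m n (F : ℕ → ℕ → ℤ) → ∑< m (λ a → ∑< n (F a)) ≡ ∑< n (λ b → ∑< m (λ a → F a b))
∑<-comm zero    n F = sym (∑<-zero n)
∑<-comm (suc m) n F = trans (cong (λ z → ∑< n (F 0) + z) (∑<-comm m n (F ∘ suc)))
                            (sym (∑<-distrib-+ n (F 0) _))

∑<-𝟙≟ : ∀ n k (F : ℕ → ℤ) → k < n → ∑< n (λ a → 𝟙 (a ℕ.≟ k) * F a) ≡ F k
∑<-𝟙≟ (suc n) zero    F _         = trans (cong₂ _+_ (ℤₚ.*-identityˡ (F 0)) (∑<-zero n)) (ℤₚ.+-identityʳ (F 0))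
∑<-𝟙≟ (suc n) (suc k) F (s≤s k<n) = trans (ℤₚ.+-identityˡ _) (∑<-𝟙≟ n k (F ∘ suc) k<n)

∑<-𝟙≟suc : ∀ n k (F : ℕ → ℤ) → 1 ≤ k → k ≤ n → ∑< n (λ a → 𝟙 (suc a ℕ.≟ k) * F (suc a)) ≡ F k
∑<-𝟙≟suc n (suc k) F _ k<n = ∑<-𝟙≟ n k (F ∘ suc) k<n

∑<-𝟙< : ∀ n T (F : ℕ → ℤ) → T ≤ n → ∑< n (λ a → 𝟙 (a <? T) * F a) ≡ ∑< T F
∑<-𝟙< n       zero    F _         = ∑<-zero n
∑<-𝟙< (suc n) (suc T) F (s≤s T≤n) = cong₂ _+_ (ℤₚ.*-identityˡ (F 0)) (∑<-𝟙< n T (F ∘ suc) T≤n)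

∑<-telescope : ∀ n (F : ℕ → ℤ) → ∑< n (λ a → F (suc a) - F a) ≡ F n - F 0
∑<-telescope zero    F = sym (ℤₚ.+-inverseʳ (F 0))
∑<-telescope (suc n) F rewrite ∑<-telescope n (F ∘ suc) =
  solve 3 (λ a b c → (b :- a) :+ (c :- b) := c :- a) refl (F 0) (F 1) (F (suc n))

sumℤ-allFin : ∀ n (f : Fin n → ℤ) (F : ℕ → ℤ) → (∀ a → f a ≡ F (toℕ a)) → sumℤ (map f (allFin n)) ≡ ∑< n F
sumℤ-allFin n f F f≡F = trans (cong sumℤ (map-tabulate (λ a → a) f)) (tabulated n f F f≡F)
  where
  tabulated : ∀ n (f : Fin n → ℤ) (F : ℕ → ℤ) → (∀ a → f a ≡ F (toℕ a)) → sumℤ (tabulate f) ≡ ∑< n F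
  tabulated zero    f F f≡F = refl
  tabulated (suc n) f F f≡F = cong₂ _+_ (f≡F Fin.zero) (tabulated n (f ∘ Fin.suc) (F ∘ suc) (f≡F ∘ Fin.suc))

sumℤ-++ : ∀ {X : Set} (xs ys : List X) (f : X → ℤ) → sumℤ (map f (xs ++ ys)) ≡ sumℤ (map f xs) + sumℤ (map f ys)
sumℤ-++ []       ys f = sym (ℤₚ.+-identityˡ _)
sumℤ-++ (x ∷ xs) ys f rewrite sumℤ-++ xs ys f = sym (ℤₚ.+-assoc (f x) _ _)

sumℤ-range1 : ∀ R (F : ℕ → ℤ) → sumℤ (map F (range1 R)) ≡ ∑< R (F ∘ suc)
sumℤ-range1 zero    F = refl
sumℤ-range1 (suc R) F rewrite sumℤ-++ (range1 R) (suc R ∷ []) F | sumℤ-range1 R F =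
  trans (cong (λ z → ∑< R (F ∘ suc) + z) (ℤₚ.+-identityʳ (F (suc R)))) (sym (∑<-init-last R (F ∘ suc)))

-- Divisibility and products of naturals

^-monoʳ-∣ : ∀ b {m n} → m ≤ n → b ^ m ∣ b ^ n
^-monoʳ-∣ b {m} {n} m≤n = divides (b ^ (n ∸ m))
  (trans (cong (b ^_) (sym (ℕₚ.m∸n+n≡m m≤n))) (ℕₚ.^-distribˡ-+-* b (n ∸ m) m))

∣-+-⇔ʳ : ∀ {d m n} → d ∣ n → (d ∣ m ⇔ d ∣ m ℕ.+ n)
∣-+-⇔ʳ {d} {m} {n} d∣n = mk⇔ (λ d∣m → ∣m∣n⇒∣m+n d∣m d∣n)
                             (λ d∣m+n → ∣m+n∣m⇒∣n (subst (d ∣_) (ℕₚ.+-comm m n) d∣m+n) d∣n)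

∣-∸1-* : ∀ {d a b} → 1 ≤ a → 1 ≤ b → d ∣ a ∸ 1 → d ∣ b ∸ 1 → d ∣ a ℕ.* b ∸ 1
∣-∸1-* {d} {suc a} {suc b} _ _ d∣a d∣b = ∣m∣n⇒∣m+n d∣b (∣m⇒∣m*n (suc b) d∣a)

*∸1-split : ∀ {P M F H Q} → 1 ≤ P → 1 ≤ M → F ℕ.* Q ≡ M ∸ 1 → H ℕ.* Q ≡ P ∸ 1 → P ℕ.* M ∸ 1 ≡ (P ℕ.* F ℕ.+ H) ℕ.* Q
*∸1-split {suc p′} {suc m′} {F} {H} {Q} _ _ FQ≡m′ HQ≡p′ = begin
  m′ ℕ.+ p′ ℕ.* suc m′                  ≡⟨ cong (m′ ℕ.+_) (trans (ℕₚ.*-suc p′ m′) (ℕₚ.+-comm p′ _)) ⟩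
  m′ ℕ.+ (p′ ℕ.* m′ ℕ.+ p′)             ≡⟨ ℕₚ.+-assoc m′ _ p′ ⟨
  suc p′ ℕ.* m′ ℕ.+ p′                  ≡⟨ cong₂ (λ u v → suc p′ ℕ.* u ℕ.+ v) (sym FQ≡m′) (sym HQ≡p′) ⟩
  suc p′ ℕ.* (F ℕ.* Q) ℕ.+ H ℕ.* Q      ≡⟨ cong (ℕ._+ H ℕ.* Q) (sym (ℕₚ.*-assoc (suc p′) F Q)) ⟩
  suc p′ ℕ.* F ℕ.* Q ℕ.+ H ℕ.* Q        ≡⟨ ℕₚ.*-distribʳ-+ Q (suc p′ ℕ.* F) H ⟨
  (suc p′ ℕ.* F ℕ.+ H) ℕ.* Q            ∎
  where open ≡-Reasoning

prodℕ-ones : ∀ {X : Set} (xs : List X) → prodℕ (map (λ _ → 1) xs) ≡ 1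
prodℕ-ones []       = refl
prodℕ-ones (x ∷ xs) = trans (ℕₚ.+-identityʳ _) (prodℕ-ones xs)

∑<-𝟙∣-window : ∀ d .{{_ : NonZero d}} c → ∑< d (λ a → 𝟙 (d ∣? c ℕ.+ a)) ≡ + 1
∑<-𝟙∣-window d@(suc e) zero = begin
  𝟙 (d ∣? 0) + ∑< e (λ a → 𝟙 (d ∣? suc a))   ≡⟨ cong₂ _+_ (𝟙-yes (d ∣? 0) (d ∣0)) (∑<-cong e small) ⟩
  + 1 + ∑< e (λ _ → + 0)                     ≡⟨ cong (λ z → + 1 + z) (∑<-zero e) ⟩
  + 1                                        ∎
  where
  open ≡-Reasoning
  small : ∀ a → a < e → 𝟙 (d ∣? suc a) ≡ + 0
  small a a<e = 𝟙-no (d ∣? suc a) (λ d∣1+a → ℕₚ.<⇒≱ a<e (ℕₚ.≤-pred (∣⇒≤ d∣1+a)))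
-- Moving the window from c to c + 1 exchanges c for c + d, which is divisible by d exactly when c is.
∑<-𝟙∣-window d@(suc e) (suc c) = begin
  ∑< d (λ a → 𝟙 (d ∣? suc c ℕ.+ a))
    ≡⟨ ∑<-init-last e _ ⟩
  ∑< e (λ a → 𝟙 (d ∣? suc c ℕ.+ a)) + 𝟙 (d ∣? suc c ℕ.+ e)
    ≡⟨ cong₂ _+_ (∑<-cong e (λ a _ → cong (𝟙 ∘ (d ∣?_)) (sym (ℕₚ.+-suc c a)))) last≡first ⟩
  ∑< e (λ a → 𝟙 (d ∣? c ℕ.+ suc a)) + 𝟙 (d ∣? c ℕ.+ 0)
    ≡⟨ ℤₚ.+-comm (∑< e (λ a → 𝟙 (d ∣? c ℕ.+ suc a))) _ ⟩
  ∑< d (λ a → 𝟙 (d ∣? c ℕ.+ a))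
    ≡⟨ ∑<-𝟙∣-window d c ⟩
  + 1
    ∎
  where
  open ≡-Reasoning
  last≡first : 𝟙 (d ∣? suc c ℕ.+ e) ≡ 𝟙 (d ∣? c ℕ.+ 0)
  last≡first rewrite ℕₚ.+-identityʳ c | sym (ℕₚ.+-suc c e) =
    sym (𝟙-⇔ (∣-+-⇔ʳ (∣-refl {d})) (d ∣? c) (d ∣? c ℕ.+ d))

∑<-𝟙∣-windows : ∀ d .{{_ : NonZero d}} c k → ∑< (d ℕ.* k) (λ a → 𝟙 (d ∣? c ℕ.+ a)) ≡ + k
∑<-𝟙∣-windows d c zero    rewrite ℕₚ.*-zeroʳ d = refl
∑<-𝟙∣-windows d c (suc k) rewrite ℕₚ.*-suc d k = begin
  ∑< (d ℕ.+ d ℕ.* k) (λ a → 𝟙 (d ∣? c ℕ.+ a))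
    ≡⟨ ∑<-+ d (d ℕ.* k) _ ⟩
  ∑< d (λ a → 𝟙 (d ∣? c ℕ.+ a)) + ∑< (d ℕ.* k) (λ a → 𝟙 (d ∣? c ℕ.+ (d ℕ.+ a)))
    ≡⟨ cong₂ _+_ (∑<-𝟙∣-window d c) (∑<-cong (d ℕ.* k) (λ a _ → cong (𝟙 ∘ (d ∣?_)) (sym (ℕₚ.+-assoc c d a)))) ⟩
  + 1 + ∑< (d ℕ.* k) (λ a → 𝟙 (d ∣? (c ℕ.+ d) ℕ.+ a))
    ≡⟨ cong (λ z → + 1 + z) (∑<-𝟙∣-windows d (c ℕ.+ d) k) ⟩
  + suc k
    ∎
  where open ≡-Reasoning

∏above : ℕ → (ℕ → ℕ) → ℕ → ℕ
∏above R m i = prodℕ (map m (filter (λ j → i <? j) (range1 R)))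

∏above-snoc : ∀ R m i → ∏above (suc R) m i ≡ ∏above R m i ℕ.* prodℕ (map m (filter (λ j → i <? j) (suc R ∷ [])))
∏above-snoc R m i rewrite filter-++ (λ j → i <? j) (range1 R) (suc R ∷ [])
                        | map-++ m (filter (λ j → i <? j) (range1 R)) (filter (λ j → i <? j) (suc R ∷ [])) =
  product-++ (map m (filter (λ j → i <? j) (range1 R))) _

∏above-snoc-< : ∀ R m i → i < suc R → ∏above (suc R) m i ≡ ∏above R m i ℕ.* m (suc R)
∏above-snoc-< R m i i<1+R rewrite ∏above-snoc R m i | filter-accept (λ j → i <? j) {xs = []} i<1+R =
  cong (∏above R m i ℕ.*_) (ℕₚ.*-identityʳ (m (suc R)))

∏above-snoc-≮ : ∀ R m i → ¬ i < suc R → ∏above (suc R) m i ≡ ∏above R m i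
∏above-snoc-≮ R m i i≮1+R rewrite ∏above-snoc R m i | filter-reject (λ j → i <? j) {xs = []} i≮1+R =
  ℕₚ.*-identityʳ (∏above R m i)

∏above-≥ : ∀ R m i → R ≤ i → ∏above R m i ≡ 1
∏above-≥ zero    m i _   = refl
∏above-≥ (suc R) m i R<i = trans (∏above-snoc-≮ R m i (ℕₚ.<⇒≱ (s≤s R<i))) (∏above-≥ R m i (ℕₚ.<⇒≤ R<i))

∏above-cong : ∀ R {m m′ : ℕ → ℕ} i → (∀ j → i < j → j ≤ R → m j ≡ m′ j) → ∏above R m i ≡ ∏above R m′ i
∏above-cong zero    i m≡m′ = refl
∏above-cong (suc R) {m} {m′} i m≡m′ with i <? suc R
... | yes i<1+R = begin
  ∏above (suc R) m i
    ≡⟨ ∏above-snoc-< R m i i<1+R ⟩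
  ∏above R m i ℕ.* m (suc R)
    ≡⟨ cong₂ ℕ._*_ (∏above-cong R i (λ j i<j j≤R → m≡m′ j i<j (ℕₚ.m≤n⇒m≤1+n j≤R))) (m≡m′ (suc R) i<1+R ℕₚ.≤-refl) ⟩
  ∏above R m′ i ℕ.* m′ (suc R)
    ≡⟨ ∏above-snoc-< R m′ i i<1+R ⟨
  ∏above (suc R) m′ i
    ∎
  where open ≡-Reasoning
... | no i≮1+R = trans (∏above-snoc-≮ R m i i≮1+R)
                 (trans (∏above-cong R i (λ j i<j j≤R → m≡m′ j i<j (ℕₚ.m≤n⇒m≤1+n j≤R)))
                        (sym (∏above-snoc-≮ R m′ i i≮1+R)))

∏above-step : ∀ R m s → s < R → ∏above R m s ≡ m (suc s) ℕ.* ∏above R m (suc s)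
∏above-step (suc R) m s (s≤s s≤R) with ℕₚ.m≤n⇒m<n∨m≡n s≤R
... | inj₂ refl = begin
  ∏above (suc s) m s                     ≡⟨ ∏above-snoc-< s m s ℕₚ.≤-refl ⟩
  ∏above s m s ℕ.* m (suc s)             ≡⟨ cong (ℕ._* m (suc s)) (∏above-≥ s m s ℕₚ.≤-refl) ⟩
  1 ℕ.* m (suc s)                        ≡⟨ ℕₚ.*-comm 1 (m (suc s)) ⟩
  m (suc s) ℕ.* 1                        ≡⟨ cong (m (suc s) ℕ.*_) (∏above-≥ (suc s) m (suc s) ℕₚ.≤-refl) ⟨
  m (suc s) ℕ.* ∏above (suc s) m (suc s) ∎
  where open ≡-Reasoning
... | inj₁ s<R = begin
  ∏above (suc R) m s
    ≡⟨ ∏above-snoc-< R m s (s≤s s≤R) ⟩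
  ∏above R m s ℕ.* m (suc R)
    ≡⟨ cong (ℕ._* m (suc R)) (∏above-step R m s s<R) ⟩
  m (suc s) ℕ.* ∏above R m (suc s) ℕ.* m (suc R)
    ≡⟨ ℕₚ.*-assoc (m (suc s)) _ _ ⟩
  m (suc s) ℕ.* (∏above R m (suc s) ℕ.* m (suc R))
    ≡⟨ cong (m (suc s) ℕ.*_) (∏above-snoc-< R m (suc s) (s≤s s<R)) ⟨
  m (suc s) ℕ.* ∏above (suc R) m (suc s)
    ∎
  where open ≡-Reasoning

∏above-scale : ∀ R {m m′ : ℕ → ℕ} q i t → i < t → t ≤ R →
  (∀ j → j ≢ t → m′ j ≡ m j) → m′ t ≡ q ℕ.* m t → ∏above R m′ i ≡ q ℕ.* ∏above R m i
∏above-scale zero    q i zero () z≤n _ _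
∏above-scale (suc R) {m} {m′} q i t i<t t≤1+R m′≡m m′t≡qmt with ℕₚ.m≤n⇒m<n∨m≡n t≤1+R
... | inj₂ refl = begin
  ∏above (suc R) m′ i
    ≡⟨ ∏above-snoc-< R m′ i i<t ⟩
  ∏above R m′ i ℕ.* m′ (suc R)
    ≡⟨ cong₂ ℕ._*_ (∏above-cong R i (λ j _ j≤R → m′≡m j (ℕₚ.<⇒≢ (s≤s j≤R)))) m′t≡qmt ⟩
  ∏above R m i ℕ.* (q ℕ.* m (suc R))
    ≡⟨ ℕₚ.*-comm (∏above R m i) _ ⟩
  q ℕ.* m (suc R) ℕ.* ∏above R m i
    ≡⟨ ℕₚ.*-assoc q _ _ ⟩
  q ℕ.* (m (suc R) ℕ.* ∏above R m i)
    ≡⟨ cong (q ℕ.*_) (ℕₚ.*-comm (m (suc R)) _) ⟩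
  q ℕ.* (∏above R m i ℕ.* m (suc R))
    ≡⟨ cong (q ℕ.*_) (∏above-snoc-< R m i i<t) ⟨
  q ℕ.* ∏above (suc R) m i
    ∎
  where open ≡-Reasoning
... | inj₁ (s≤s t≤R) = begin
  ∏above (suc R) m′ i
    ≡⟨ ∏above-snoc-< R m′ i i<1+R ⟩
  ∏above R m′ i ℕ.* m′ (suc R)
    ≡⟨ cong₂ ℕ._*_ (∏above-scale R q i t i<t t≤R m′≡m m′t≡qmt) (m′≡m (suc R) (ℕₚ.>⇒≢ (s≤s t≤R))) ⟩
  q ℕ.* ∏above R m i ℕ.* m (suc R)
    ≡⟨ ℕₚ.*-assoc q _ _ ⟩
  q ℕ.* (∏above R m i ℕ.* m (suc R))
    ≡⟨ cong (q ℕ.*_) (∏above-snoc-< R m i i<1+R) ⟨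
  q ℕ.* ∏above (suc R) m i
    ∎
  where
  open ≡-Reasoning
  i<1+R = ℕₚ.<-trans i<t (s≤s t≤R)

-- The group ring ℤ[ℤ/2^r]

module CyclicGroupRing (r : ℕ) where

  N : ℕ
  N = Order r

  instance
    N≢0 : NonZero N
    N≢0 = m^n≢0 2 r

  infixl 6 _⊖_
  _⊖_ : ℕ → ℕ → ℕ
  x ⊖ a = (x ℕ.+ (N ∸ a)) % N

  ⊖<N : ∀ x a → x ⊖ a < N
  ⊖<N x a = m%n<n (x ℕ.+ (N ∸ a)) N

  [m%N+k]%N≡[m+k]%N : ∀ m k → (m % N ℕ.+ k) % N ≡ (m ℕ.+ k) % N
  [m%N+k]%N≡[m+k]%N m k = begin
    (m % N ℕ.+ k) % N                ≡⟨ %-distribˡ-+ (m % N) k N ⟩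
    (m % N % N ℕ.+ k % N) % N        ≡⟨ cong (λ z → (z ℕ.+ k % N) % N) (m%n%n≡m%n m N) ⟩
    (m % N ℕ.+ k % N) % N            ≡⟨ %-distribˡ-+ m k N ⟨
    (m ℕ.+ k) % N                    ∎
    where open ≡-Reasoning

  ⊖-unique : ∀ {a b x} → a ≤ N → b < N → (a ℕ.+ b) % N ≡ x → b ≡ x ⊖ a
  ⊖-unique {a} {b} {x} a≤N b<N a+b≡x = begin
    b                                   ≡⟨ m<n⇒m%n≡m b<N ⟨
    b % N                               ≡⟨ [m+n]%n≡m%n b N ⟨
    (b ℕ.+ N) % N                       ≡⟨ cong (_% N) (solve-b+N) ⟩
    (a ℕ.+ b ℕ.+ (N ∸ a)) % N           ≡⟨ [m%N+k]%N≡[m+k]%N (a ℕ.+ b) (N ∸ a) ⟨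
    ((a ℕ.+ b) % N ℕ.+ (N ∸ a)) % N     ≡⟨ cong (λ z → (z ℕ.+ (N ∸ a)) % N) a+b≡x ⟩
    x ⊖ a                               ∎
    where
    open ≡-Reasoning
    solve-b+N : b ℕ.+ N ≡ a ℕ.+ b ℕ.+ (N ∸ a)
    solve-b+N = begin
      b ℕ.+ N                  ≡⟨ cong (b ℕ.+_) (ℕₚ.m+[n∸m]≡n a≤N) ⟨
      b ℕ.+ (a ℕ.+ (N ∸ a))    ≡⟨ ℕₚ.+-assoc b a (N ∸ a) ⟨
      b ℕ.+ a ℕ.+ (N ∸ a)      ≡⟨ cong (ℕ._+ (N ∸ a)) (ℕₚ.+-comm b a) ⟩
      a ℕ.+ b ℕ.+ (N ∸ a)      ∎

  +-⊖-cancel : ∀ {a x} → a ≤ N → x < N → (a ℕ.+ (x ⊖ a)) % N ≡ x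
  +-⊖-cancel {a} {x} a≤N x<N = begin
    (a ℕ.+ (x ⊖ a)) % N                   ≡⟨ cong (_% N) (ℕₚ.+-comm a (x ⊖ a)) ⟩
    ((x ⊖ a) ℕ.+ a) % N                   ≡⟨ [m%N+k]%N≡[m+k]%N (x ℕ.+ (N ∸ a)) a ⟩
    (x ℕ.+ (N ∸ a) ℕ.+ a) % N           ≡⟨ cong (_% N) (ℕₚ.+-assoc x (N ∸ a) a) ⟩
    (x ℕ.+ (N ∸ a ℕ.+ a)) % N           ≡⟨ cong (λ z → (x ℕ.+ z) % N) (ℕₚ.m∸n+n≡m a≤N) ⟩
    (x ℕ.+ N) % N                       ≡⟨ [m+n]%n≡m%n x N ⟩
    x % N                               ≡⟨ m<n⇒m%n≡m x<N ⟩
    x                                   ∎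
    where open ≡-Reasoning

  ⊖-involutive : ∀ {x a} → x < N → a < N → x ⊖ (x ⊖ a) ≡ a
  ⊖-involutive {x} {a} x<N a<N = sym (⊖-unique (ℕₚ.<⇒≤ (⊖<N x a)) a<N
    (trans (cong (_% N) (ℕₚ.+-comm (x ⊖ a) a)) (+-⊖-cancel (ℕₚ.<⇒≤ a<N) x<N)))

  [a+b]%N≡x⇔b≡x⊖a : ∀ {a b x} → a < N → b < N → x < N → ((a ℕ.+ b) % N ≡ x ⇔ b ≡ x ⊖ a)
  [a+b]%N≡x⇔b≡x⊖a {a} a<N b<N x<N =
    mk⇔ (⊖-unique (ℕₚ.<⇒≤ a<N) b<N)
        (λ b≡x⊖a → trans (cong (λ z → (a ℕ.+ z) % N) b≡x⊖a) (+-⊖-cancel (ℕₚ.<⇒≤ a<N) x<N))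

  x⊖a≡c⇔a≡x⊖c : ∀ {x a c} → x < N → a < N → c < N → (x ⊖ a ≡ c ⇔ a ≡ x ⊖ c)
  x⊖a≡c⇔a≡x⊖c {x} x<N a<N c<N =
    mk⇔ (λ x⊖a≡c → trans (sym (⊖-involutive x<N a<N)) (cong (x ⊖_) x⊖a≡c))
        (λ a≡x⊖c → trans (cong (x ⊖_) a≡x⊖c) (⊖-involutive x<N c<N))

  x⊖y≡c⇔x≡[y+c]%N : ∀ {x y c} → x < N → y < N → c < N → (x ⊖ y ≡ c ⇔ x ≡ (y ℕ.+ c) % N)
  x⊖y≡c⇔x≡[y+c]%N {x} {y} x<N y<N c<N =
    mk⇔ (λ x⊖y≡c → trans (sym (+-⊖-cancel (ℕₚ.<⇒≤ y<N) x<N)) (cong (λ z → (y ℕ.+ z) % N) x⊖y≡c))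
        (λ x≡y+c → sym (⊖-unique (ℕₚ.<⇒≤ y<N) c<N (sym x≡y+c)))

  ∣-%N⇔ : ∀ {d y} → d ∣ N → (d ∣ y % N ⇔ d ∣ y)
  ∣-%N⇔ d∣N = mk⇔ (∣n∣m%n⇒∣m d∣N) (λ d∣y → %-presˡ-∣ d∣y d∣N)

  𝟙∣-⊖ : ∀ {d} x {a} → d ∣ N → d ∣ a → a ≤ N → 𝟙 (d ∣? x ⊖ a) ≡ 𝟙 (d ∣? x)
  𝟙∣-⊖ {d} x {a} d∣N d∣a a≤N = begin
    𝟙 (d ∣? x ⊖ a)
      ≡⟨ 𝟙-⇔ (∣-%N⇔ d∣N) (d ∣? x ⊖ a) (d ∣? x ℕ.+ (N ∸ a)) ⟩
    𝟙 (d ∣? x ℕ.+ (N ∸ a))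
      ≡⟨ 𝟙-⇔ (∣-+-⇔ʳ d∣a) (d ∣? x ℕ.+ (N ∸ a)) (d ∣? x ℕ.+ (N ∸ a) ℕ.+ a) ⟩
    𝟙 (d ∣? x ℕ.+ (N ∸ a) ℕ.+ a)
      ≡⟨ cong (𝟙 ∘ (d ∣?_)) (trans (ℕₚ.+-assoc x (N ∸ a) a) (cong (x ℕ.+_) (ℕₚ.m∸n+n≡m a≤N))) ⟩
    𝟙 (d ∣? x ℕ.+ N)
      ≡⟨ 𝟙-⇔ (∣-+-⇔ʳ d∣N) (d ∣? x) (d ∣? x ℕ.+ N) ⟨
    𝟙 (d ∣? x)
      ∎
    where open ≡-Reasoning

  𝟙∣-⊖-swap : ∀ {d x a} → x < N → a < N → d ∣ N → d ∣ x ⊖ a → 𝟙 (d ∣? a) ≡ 𝟙 (d ∣? x)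
  𝟙∣-⊖-swap {d} {x} {a} x<N a<N d∣N d∣x⊖a =
    trans (cong (𝟙 ∘ (d ∣?_)) (sym (⊖-involutive x<N a<N))) (𝟙∣-⊖ x d∣N d∣x⊖a (ℕₚ.<⇒≤ (⊖<N x a)))

  infix 4 _represents_
  _represents_ : ZG r → (ℕ → ℤ) → Set
  u represents X = ∀ g → coeff u g ≡ X (toℕ g)

  infixl 7 _⋆_
  _⋆_ : (ℕ → ℤ) → (ℕ → ℤ) → ℕ → ℤ
  (X ⋆ Y) x = ∑< N (λ a → X a * Y (x ⊖ a))

  ⊛-represents : ∀ {u v X Y} → u represents X → v represents Y → u ⊛ v represents X ⋆ Y
  ⊛-represents {u} {v} {X} {Y} u≈X v≈Y g = begin
    coeff (u ⊛ v) g
      ≡⟨ sumℤ-allFin N _ _ (λ a → sumℤ-allFin N _ _ (λ b → cong₂ (term (toℕ a) (toℕ b)) (u≈X a) (v≈Y b))) ⟩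
    ∑< N (λ a → ∑< N (λ b → term a b (X a) (Y b)))
      ≡⟨ ∑<-cong N (λ a a<N → ∑<-cong N (λ b b<N → term≡ a<N b<N)) ⟩
    ∑< N (λ a → ∑< N (λ b → 𝟙 (b ℕ.≟ x ⊖ a) * (X a * Y b)))
      ≡⟨ ∑<-cong N (λ a _ → ∑<-𝟙≟ N (x ⊖ a) (λ b → X a * Y b) (⊖<N x a)) ⟩
    (X ⋆ Y) x
      ∎
    where
    open ≡-Reasoning
    x = toℕ g
    term : ℕ → ℕ → ℤ → ℤ → ℤ
    term a b xa yb = if does ((a ℕ.+ b) % N ℕ.≟ x) then xa * yb else + 0
    term≡ : ∀ {a b} → a < N → b < N → term a b (X a) (Y b) ≡ 𝟙 (b ℕ.≟ x ⊖ a) * (X a * Y b)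
    term≡ {a} {b} a<N b<N = trans (if-then-0 (does ((a ℕ.+ b) % N ℕ.≟ x)) (X a * Y b))
      (cong (_* (X a * Y b)) (𝟙-⇔ ([a+b]%N≡x⇔b≡x⊖a a<N b<N (toℕ<n g)) ((a ℕ.+ b) % N ℕ.≟ x) (b ℕ.≟ x ⊖ a)))

  -- The coefficient functions of elt r c and of SigmaSub r i.
  δ : ℕ → ℕ → ℤ
  δ c x = 𝟙 (x ℕ.≟ c)

  𝟙⟨_⟩ : ℕ → ℕ → ℤ
  𝟙⟨ i ⟩ x = 𝟙 (2 ^ (r ∸ i) ∣? x)

  2^[r∸i]∣N : ∀ i → 2 ^ (r ∸ i) ∣ N
  2^[r∸i]∣N i = ^-monoʳ-∣ 2 (ℕₚ.m∸n≤m r i)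

  2^[r∸i]*2^i≡N : ∀ {i} → i ≤ r → 2 ^ (r ∸ i) ℕ.* 2 ^ i ≡ N
  2^[r∸i]*2^i≡N {i} i≤r = trans (sym (ℕₚ.^-distribˡ-+-* 2 (r ∸ i) i)) (cong (2 ^_) (ℕₚ.m∸n+n≡m i≤r))

  ∑<-𝟙⟨⟩ : ∀ {i} → i ≤ r → ∑< N 𝟙⟨ i ⟩ ≡ + 2 ^ i
  ∑<-𝟙⟨⟩ {i} i≤r = trans (cong (λ n → ∑< n 𝟙⟨ i ⟩) (sym (2^[r∸i]*2^i≡N i≤r)))
                         (∑<-𝟙∣-windows (2 ^ (r ∸ i)) ⦃ m^n≢0 2 (r ∸ i) ⦄ 0 (2 ^ i))

  ∑<-𝟙⟨⟩-⊖ : ∀ {i} x → i ≤ r → ∑< N (λ a → 𝟙⟨ i ⟩ (x ⊖ a)) ≡ + 2 ^ i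
  -- As a runs through [0, N), x + (N ∸ a) runs through the window x + 1, …, x + N.
  ∑<-𝟙⟨⟩-⊖ {i} x i≤r = begin
    ∑< N (λ a → 𝟙 (E ∣? x ⊖ a))
      ≡⟨ ∑<-cong N (λ a _ → 𝟙-⇔ (∣-%N⇔ (2^[r∸i]∣N i)) (E ∣? x ⊖ a) (E ∣? x ℕ.+ (N ∸ a))) ⟩
    ∑< N (λ a → 𝟙 (E ∣? x ℕ.+ (N ∸ a)))
      ≡⟨ ∑<-reverse N _ ⟩
    ∑< N (λ a → 𝟙 (E ∣? x ℕ.+ (N ∸ (N ∸ suc a))))
      ≡⟨ ∑<-cong N (λ a a<N → cong (λ z → 𝟙 (E ∣? x ℕ.+ z)) (ℕₚ.m∸[m∸n]≡n a<N)) ⟩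
    ∑< N (λ a → 𝟙 (E ∣? x ℕ.+ suc a))
      ≡⟨ ∑<-cong N (λ a _ → cong (𝟙 ∘ (E ∣?_)) (ℕₚ.+-suc x a)) ⟩
    ∑< N (λ a → 𝟙 (E ∣? suc x ℕ.+ a))
      ≡⟨ cong (λ n → ∑< n (λ a → 𝟙 (E ∣? suc x ℕ.+ a))) (sym (2^[r∸i]*2^i≡N i≤r)) ⟩
    ∑< (E ℕ.* 2 ^ i) (λ a → 𝟙 (E ∣? suc x ℕ.+ a))
      ≡⟨ ∑<-𝟙∣-windows E ⦃ m^n≢0 2 (r ∸ i) ⦄ (suc x) (2 ^ i) ⟩
    + 2 ^ i
      ∎
    where
    open ≡-Reasoning
    E = 2 ^ (r ∸ i)

  δ⋆ : ∀ {y} (Z : ℕ → ℤ) x → y < N → (δ y ⋆ Z) x ≡ Z (x ⊖ y)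
  δ⋆ {y} Z x y<N = ∑<-𝟙≟ N y (λ a → Z (x ⊖ a)) y<N

  ⋆δ : ∀ (X : ℕ → ℤ) {x c} → x < N → c < N → (X ⋆ δ c) x ≡ X (x ⊖ c)
  ⋆δ X {x} {c} x<N c<N = trans (∑<-cong N (λ a a<N → trans (ℤₚ.*-comm (X a) _)
                                   (cong (_* X a) (𝟙-⇔ (x⊖a≡c⇔a≡x⊖c x<N a<N c<N) (x ⊖ a ℕ.≟ c) (a ℕ.≟ x ⊖ c)))))
                               (∑<-𝟙≟ N (x ⊖ c) X (⊖<N x c))

  𝟙⟨⟩⋆𝟙⟨⟩-≤ : ∀ {i t x} → i ≤ t → t ≤ r → x < N → (𝟙⟨ t ⟩ ⋆ 𝟙⟨ i ⟩) x ≡ + 2 ^ i * 𝟙⟨ t ⟩ x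
  𝟙⟨⟩⋆𝟙⟨⟩-≤ {i} {t} {x} i≤t t≤r x<N = begin
    ∑< N (λ a → 𝟙⟨ t ⟩ a * 𝟙⟨ i ⟩ (x ⊖ a))    ≡⟨ ∑<-cong N onSupport ⟩
    ∑< N (λ a → 𝟙⟨ t ⟩ x * 𝟙⟨ i ⟩ (x ⊖ a))    ≡⟨ *-distribˡ-∑< N (𝟙⟨ t ⟩ x) _ ⟨
    𝟙⟨ t ⟩ x * ∑< N (λ a → 𝟙⟨ i ⟩ (x ⊖ a))    ≡⟨ cong (𝟙⟨ t ⟩ x *_) (∑<-𝟙⟨⟩-⊖ x (ℕₚ.≤-trans i≤t t≤r)) ⟩
    𝟙⟨ t ⟩ x * + 2 ^ i                        ≡⟨ ℤₚ.*-comm (𝟙⟨ t ⟩ x) _ ⟩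
    + 2 ^ i * 𝟙⟨ t ⟩ x                        ∎
    where
    open ≡-Reasoning
    onSupport : ∀ a → a < N → 𝟙⟨ t ⟩ a * 𝟙⟨ i ⟩ (x ⊖ a) ≡ 𝟙⟨ t ⟩ x * 𝟙⟨ i ⟩ (x ⊖ a)
    onSupport a a<N = *𝟙-cong (2 ^ (r ∸ i) ∣? x ⊖ a) (λ Eᵢ∣x⊖a →
      𝟙∣-⊖-swap x<N a<N (2^[r∸i]∣N t) (∣-trans (^-monoʳ-∣ 2 (ℕₚ.∸-monoʳ-≤ r i≤t)) Eᵢ∣x⊖a))

  𝟙⟨⟩⋆𝟙⟨⟩-≥ : ∀ {i t} x → t ≤ i → i ≤ r → (𝟙⟨ t ⟩ ⋆ 𝟙⟨ i ⟩) x ≡ + 2 ^ t * 𝟙⟨ i ⟩ x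
  𝟙⟨⟩⋆𝟙⟨⟩-≥ {i} {t} x t≤i i≤r = begin
    ∑< N (λ a → 𝟙⟨ t ⟩ a * 𝟙⟨ i ⟩ (x ⊖ a))    ≡⟨ ∑<-cong N onSupport ⟩
    ∑< N (λ a → 𝟙⟨ t ⟩ a * 𝟙⟨ i ⟩ x)          ≡⟨ ∑<-cong N (λ a _ → ℤₚ.*-comm (𝟙⟨ t ⟩ a) _) ⟩
    ∑< N (λ a → 𝟙⟨ i ⟩ x * 𝟙⟨ t ⟩ a)          ≡⟨ *-distribˡ-∑< N (𝟙⟨ i ⟩ x) _ ⟨
    𝟙⟨ i ⟩ x * ∑< N 𝟙⟨ t ⟩                    ≡⟨ cong (𝟙⟨ i ⟩ x *_) (∑<-𝟙⟨⟩ (ℕₚ.≤-trans t≤i i≤r)) ⟩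
    𝟙⟨ i ⟩ x * + 2 ^ t                        ≡⟨ ℤₚ.*-comm (𝟙⟨ i ⟩ x) _ ⟩
    + 2 ^ t * 𝟙⟨ i ⟩ x                        ∎
    where
    open ≡-Reasoning
    onSupport : ∀ a → a < N → 𝟙⟨ t ⟩ a * 𝟙⟨ i ⟩ (x ⊖ a) ≡ 𝟙⟨ t ⟩ a * 𝟙⟨ i ⟩ x
    onSupport a a<N = 𝟙*-cong (2 ^ (r ∸ t) ∣? a) (λ Eₜ∣a →
      𝟙∣-⊖ x (2^[r∸i]∣N i) (∣-trans (^-monoʳ-∣ 2 (ℕₚ.∸-monoʳ-≤ r t≤i)) Eₜ∣a) (ℕₚ.<⇒≤ a<N))

  ⋆-linearˡ : ∀ c d (X Y Z : ℕ → ℤ) x → ((λ a → c * X a + d * Y a) ⋆ Z) x ≡ c * (X ⋆ Z) x + d * (Y ⋆ Z) x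
  ⋆-linearˡ c d X Y Z x = begin
    ∑< N (λ a → (c * X a + d * Y a) * Z (x ⊖ a))
      ≡⟨ ∑<-cong N (λ a _ → distribute (X a) (Y a) (Z (x ⊖ a))) ⟩
    ∑< N (λ a → c * (X a * Z (x ⊖ a)) + d * (Y a * Z (x ⊖ a)))
      ≡⟨ ∑<-distrib-+ N _ _ ⟩
    ∑< N (λ a → c * (X a * Z (x ⊖ a))) + ∑< N (λ a → d * (Y a * Z (x ⊖ a)))
      ≡⟨ cong₂ _+_ (*-distribˡ-∑< N c _) (*-distribˡ-∑< N d _) ⟨
    c * (X ⋆ Z) x + d * (Y ⋆ Z) x
      ∎
    where
    open ≡-Reasoning
    distribute : ∀ u v w → (c * u + d * v) * w ≡ c * (u * w) + d * (v * w)
    distribute = solve 5 (λ c d u v w → (c :* u :+ d :* v) :* w := c :* (u :* w) :+ d :* (v :* w)) refl c d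

  ⋆-linearʳ : ∀ (X Y : ℕ → ℤ) A R (b : ℕ → ℤ) (Z : ℕ → ℕ → ℤ) x →
    (X ⋆ (λ u → A * Y u + ∑< R (λ j → b j * Z j u))) x ≡ A * (X ⋆ Y) x + ∑< R (λ j → b j * (X ⋆ Z j) x)
  ⋆-linearʳ X Y A R b Z x = begin
    ∑< N (λ a → X a * (A * Y (x ⊖ a) + ∑< R (λ j → b j * Z j (x ⊖ a))))
      ≡⟨ ∑<-cong N (λ a _ → distribute a) ⟩
    ∑< N (λ a → A * (X a * Y (x ⊖ a)) + ∑< R (λ j → b j * (X a * Z j (x ⊖ a))))
      ≡⟨ ∑<-distrib-+ N _ _ ⟩
    ∑< N (λ a → A * (X a * Y (x ⊖ a))) + ∑< N (λ a → ∑< R (λ j → b j * (X a * Z j (x ⊖ a))))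
      ≡⟨ cong₂ _+_ (sym (*-distribˡ-∑< N A _)) (∑<-comm N R _) ⟩
    A * (X ⋆ Y) x + ∑< R (λ j → ∑< N (λ a → b j * (X a * Z j (x ⊖ a))))
      ≡⟨ cong (λ z → A * (X ⋆ Y) x + z) (∑<-cong R (λ j _ → sym (*-distribˡ-∑< N (b j) _))) ⟩
    A * (X ⋆ Y) x + ∑< R (λ j → b j * (X ⋆ Z j) x)
      ∎
    where
    open ≡-Reasoning
    distribute : ∀ a → X a * (A * Y (x ⊖ a) + ∑< R (λ j → b j * Z j (x ⊖ a)))
                     ≡ A * (X a * Y (x ⊖ a)) + ∑< R (λ j → b j * (X a * Z j (x ⊖ a)))
    distribute a = trans (ℤₚ.*-distribˡ-+ (X a) _ _) (cong₂ _+_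
      (solve 3 (λ x A y → x :* (A :* y) := A :* (x :* y)) refl (X a) A (Y (x ⊖ a)))
      (trans (*-distribˡ-∑< R (X a) _) (∑<-cong R (λ j _ →
        solve 3 (λ x b z → x :* (b :* z) := b :* (x :* z)) refl (X a) (b j) (Z j (x ⊖ a))))))

  σ : ℕ
  σ = 2 ^ (r ∸ 1) % N

  infix 4 _∈⟨σ⟩
  _∈⟨σ⟩ : ℕ → Set
  y ∈⟨σ⟩ = y < N × 2 ^ (r ∸ 1) ∣ y

  0∈⟨σ⟩ : 0 % N ∈⟨σ⟩
  0∈⟨σ⟩ = m%n<n 0 N , %-presˡ-∣ ((2 ^ (r ∸ 1)) ∣0) (2^[r∸i]∣N 1)

  σ∈⟨σ⟩ : σ ∈⟨σ⟩
  σ∈⟨σ⟩ = m%n<n _ N , %-presˡ-∣ ∣-refl (2^[r∸i]∣N 1)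

  ∈⟨σ⟩-+ : ∀ {y c} → y ∈⟨σ⟩ → c ∈⟨σ⟩ → (y ℕ.+ c) % N ∈⟨σ⟩
  ∈⟨σ⟩-+ (_ , σ∣y) (_ , σ∣c) = m%n<n _ N , %-presˡ-∣ (∣m∣n⇒∣m+n σ∣y σ∣c) (2^[r∸i]∣N 1)

  𝟙⟨⟩-⊖-∈⟨σ⟩ : ∀ {i y} x → 1 ≤ i → y ∈⟨σ⟩ → 𝟙⟨ i ⟩ (x ⊖ y) ≡ 𝟙⟨ i ⟩ x
  𝟙⟨⟩-⊖-∈⟨σ⟩ {i} x 1≤i (y<N , σ∣y) =
    𝟙∣-⊖ x (2^[r∸i]∣N i) (∣-trans (^-monoʳ-∣ 2 (ℕₚ.∸-monoʳ-≤ r 1≤i)) σ∣y) (ℕₚ.<⇒≤ y<N)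

  σ^ : ℕ → ℕ
  σ^ zero    = 0 % N
  σ^ (suc e) = (σ ℕ.+ σ^ e) % N

  σ^∈⟨σ⟩ : ∀ e → σ^ e ∈⟨σ⟩
  σ^∈⟨σ⟩ zero    = 0∈⟨σ⟩
  σ^∈⟨σ⟩ (suc e) = ∈⟨σ⟩-+ σ∈⟨σ⟩ (σ^∈⟨σ⟩ e)

  powG-σ-represents : ∀ e → powG (sigmaG r) e represents δ (σ^ e)
  powG-σ-represents zero    g = refl
  powG-σ-represents (suc e) g = begin
    coeff (sigmaG r ⊛ powG (sigmaG r) e) g
      ≡⟨ ⊛-represents {X = δ σ} {Y = δ (σ^ e)} (λ _ → refl) (powG-σ-represents e) g ⟩
    (δ σ ⋆ δ (σ^ e)) x
      ≡⟨ δ⋆ (δ (σ^ e)) x (proj₁ σ∈⟨σ⟩) ⟩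
    𝟙 (x ⊖ σ ℕ.≟ σ^ e)
      ≡⟨ 𝟙-⇔ (x⊖y≡c⇔x≡[y+c]%N (toℕ<n g) (proj₁ σ∈⟨σ⟩) (proj₁ (σ^∈⟨σ⟩ e))) (x ⊖ σ ℕ.≟ σ^ e) (x ℕ.≟ σ^ (suc e)) ⟩
    δ (σ^ (suc e)) x
      ∎
    where
    open ≡-Reasoning
    x = toℕ g

-- The product over the ramified primes

module RamifiedProduct (r n : ℕ) (p t : Fin n → ℕ)
  (1≤p : ∀ k → 1 ≤ p k) (1≤t : ∀ k → 1 ≤ t k) (t≤r : ∀ k → t k ≤ r) (2^t∣p-1 : ∀ k → 2 ^ t k ∣ p k ∸ 1) where

  open Ramification r n p t using (h; isOdd; Y')

  mOf : List (Fin n) → ℕ → ℕ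
  mOf ks i = prodℕ (map p (filter (λ k → t k ℕ.≟ i) ks))

  fOf : List (Fin n) → ℕ → ℕ
  fOf ks i = ((mOf ks i ∸ 1) / 2 ^ i) ⦃ m^n≢0 2 i ⦄

  MOf : List (Fin n) → ℕ → ℕ
  MOf ks = ∏above r (mOf ks)

  aOf : List (Fin n) → ℕ → ℤ
  aOf ks i = - (+ (fOf ks i ℕ.* MOf ks i))

  a₀Of : List (Fin n) → ℕ
  a₀Of ks = prodℕ (map p ks)

  mOf-∷-≡ : ∀ k ks {j} → t k ≡ j → mOf (k ∷ ks) j ≡ p k ℕ.* mOf ks j
  mOf-∷-≡ k ks {j} tk≡j rewrite filter-accept (λ k → t k ℕ.≟ j) {x = k} {xs = ks} tk≡j = refl

  mOf-∷-≢ : ∀ k ks {j} → t k ≢ j → mOf (k ∷ ks) j ≡ mOf ks j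
  mOf-∷-≢ k ks {j} tk≢j rewrite filter-reject (λ k → t k ℕ.≟ j) {x = k} {xs = ks} tk≢j = refl

  1≤mOf : ∀ ks j → 1 ≤ mOf ks j
  1≤mOf []       j = ℕₚ.≤-refl
  1≤mOf (k ∷ ks) j with t k ℕ.≟ j
  ... | yes tk≡j = subst (1 ≤_) (sym (mOf-∷-≡ k ks tk≡j)) (ℕₚ.*-mono-≤ (1≤p k) (1≤mOf ks j))
  ... | no  tk≢j = subst (1 ≤_) (sym (mOf-∷-≢ k ks tk≢j)) (1≤mOf ks j)

  2^j∣mOf-1 : ∀ ks j → 2 ^ j ∣ mOf ks j ∸ 1
  2^j∣mOf-1 []       j = (2 ^ j) ∣0
  2^j∣mOf-1 (k ∷ ks) j with t k ℕ.≟ j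
  ... | yes refl = subst (λ m → 2 ^ t k ∣ m ∸ 1) (sym (mOf-∷-≡ k ks refl))
                         (∣-∸1-* (1≤p k) (1≤mOf ks (t k)) (2^t∣p-1 k) (2^j∣mOf-1 ks (t k)))
  ... | no  tk≢j = subst (λ m → 2 ^ j ∣ m ∸ 1) (sym (mOf-∷-≢ k ks tk≢j)) (2^j∣mOf-1 ks j)

  fOf*2^i≡mOf-1 : ∀ ks i → fOf ks i ℕ.* 2 ^ i ≡ mOf ks i ∸ 1
  fOf*2^i≡mOf-1 ks i = m/n*n≡m ⦃ m^n≢0 2 i ⦄ (2^j∣mOf-1 ks i)

  h*2^t≡p-1 : ∀ k → h k ℕ.* 2 ^ t k ≡ p k ∸ 1
  h*2^t≡p-1 k = m/n*n≡m ⦃ m^n≢0 2 (t k) ⦄ (2^t∣p-1 k)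

  fOf-∷-≢ : ∀ k ks {i} → t k ≢ i → fOf (k ∷ ks) i ≡ fOf ks i
  fOf-∷-≢ k ks {i} tk≢i = cong (λ m → ((m ∸ 1) / 2 ^ i) ⦃ m^n≢0 2 i ⦄) (mOf-∷-≢ k ks tk≢i)

  fOf-∷-≡ : ∀ k ks → fOf (k ∷ ks) (t k) ≡ p k ℕ.* fOf ks (t k) ℕ.+ h k
  fOf-∷-≡ k ks = begin
    fOf (k ∷ ks) T
      ≡⟨ cong (λ m → ((m ∸ 1) / 2 ^ T) ⦃ m^n≢0 2 T ⦄) (mOf-∷-≡ k ks refl) ⟩
    ((p k ℕ.* mOf ks T ∸ 1) / 2 ^ T) ⦃ m^n≢0 2 T ⦄
      ≡⟨ cong (λ m → (m / 2 ^ T) ⦃ m^n≢0 2 T ⦄) pm-1≡[pf+h]2^T ⟩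
    (((p k ℕ.* fOf ks T ℕ.+ h k) ℕ.* 2 ^ T) / 2 ^ T) ⦃ m^n≢0 2 T ⦄
      ≡⟨ m*n/n≡m (p k ℕ.* fOf ks T ℕ.+ h k) (2 ^ T) ⦃ m^n≢0 2 T ⦄ ⟩
    p k ℕ.* fOf ks T ℕ.+ h k
      ∎
    where
    open ≡-Reasoning
    T = t k
    pm-1≡[pf+h]2^T : p k ℕ.* mOf ks T ∸ 1 ≡ (p k ℕ.* fOf ks T ℕ.+ h k) ℕ.* 2 ^ T
    pm-1≡[pf+h]2^T = *∸1-split (1≤p k) (1≤mOf ks T) (fOf*2^i≡mOf-1 ks T) (h*2^t≡p-1 k)

  MOf-∷-< : ∀ k ks {i} → i < t k → MOf (k ∷ ks) i ≡ p k ℕ.* MOf ks i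
  MOf-∷-< k ks {i} i<tk =
    ∏above-scale r (p k) i (t k) i<tk (t≤r k) (λ j j≢tk → mOf-∷-≢ k ks (j≢tk ∘ sym)) (mOf-∷-≡ k ks refl)

  MOf-∷-≥ : ∀ k ks {i} → t k ≤ i → MOf (k ∷ ks) i ≡ MOf ks i
  MOf-∷-≥ k ks {i} tk≤i =
    ∏above-cong r i (λ j i<j _ → mOf-∷-≢ k ks (λ tk≡j → ℕₚ.<⇒≱ i<j (subst (_≤ i) tk≡j tk≤i)))

  MOf-step : ∀ ks {s} → s < r → MOf ks s ≡ mOf ks (suc s) ℕ.* MOf ks (suc s)
  MOf-step ks {s} = ∏above-step r (mOf ks) s

  MOf-0 : ∀ ks → MOf ks 0 ≡ a₀Of ks
  MOf-0 []       = prodℕ-ones (filter (λ j → 0 <? j) (range1 r))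
  MOf-0 (k ∷ ks) = trans (MOf-∷-< k ks (1≤t k)) (cong (p k ℕ.*_) (MOf-0 ks))

  aOf-[] : ∀ i → aOf [] i ≡ + 0
  aOf-[] i = cong (λ f → - + (f ℕ.* MOf [] i)) (0/n≡0 (2 ^ i) ⦃ m^n≢0 2 i ⦄)

  aOf-∷-< : ∀ k ks {i} → i < t k → aOf (k ∷ ks) i ≡ + p k * aOf ks i
  aOf-∷-< k ks {i} i<tk = begin
    - + (fOf (k ∷ ks) i ℕ.* MOf (k ∷ ks) i)
      ≡⟨ cong (λ z → - + z) (cong₂ ℕ._*_ (fOf-∷-≢ k ks (ℕₚ.>⇒≢ i<tk)) (MOf-∷-< k ks i<tk)) ⟩
    - + (fOf ks i ℕ.* (p k ℕ.* MOf ks i))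
      ≡⟨ cong (λ z → - z) (trans (ℤₚ.pos-* (fOf ks i) _) (cong (+ fOf ks i *_) (ℤₚ.pos-* (p k) _))) ⟩
    - (+ fOf ks i * (+ p k * + MOf ks i))
      ≡⟨ solve 3 (λ f P M → :- (f :* (P :* M)) := P :* (:- (f :* M))) refl (+ fOf ks i) (+ p k) (+ MOf ks i) ⟩
    + p k * - (+ fOf ks i * + MOf ks i)
      ≡⟨ cong (λ z → + p k * - z) (ℤₚ.pos-* (fOf ks i) (MOf ks i)) ⟨
    + p k * aOf ks i
      ∎
    where open ≡-Reasoning

  aOf-∷-> : ∀ k ks {i} → t k < i → aOf (k ∷ ks) i ≡ aOf ks i
  aOf-∷-> k ks {i} tk<i = cong (λ z → - + z)
    (cong₂ ℕ._*_ (fOf-∷-≢ k ks (ℕₚ.<⇒≢ tk<i)) (MOf-∷-≥ k ks (ℕₚ.<⇒≤ tk<i)))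

  aOf-∷-≡ : ∀ k ks → aOf (k ∷ ks) (t k) ≡ + p k * aOf ks (t k) - + h k * + MOf ks (t k)
  aOf-∷-≡ k ks = begin
    - + (fOf (k ∷ ks) T ℕ.* MOf (k ∷ ks) T)
      ≡⟨ cong (λ z → - + z) (cong₂ ℕ._*_ (fOf-∷-≡ k ks) (MOf-∷-≥ k ks ℕₚ.≤-refl)) ⟩
    - + ((p k ℕ.* f ℕ.+ h k) ℕ.* M)
      ≡⟨ cong -_ (ℤₚ.pos-* (p k ℕ.* f ℕ.+ h k) M) ⟩
    - (+ (p k ℕ.* f ℕ.+ h k) * + M)
      ≡⟨ cong (λ z → - (z * + M)) (trans (ℤₚ.pos-+ (p k ℕ.* f) (h k)) (cong (_+ + h k) (ℤₚ.pos-* (p k) f))) ⟩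
    - ((+ p k * + f + + h k) * + M)
      ≡⟨ solve 4 (λ P f H M → :- ((P :* f :+ H) :* M) := P :* (:- (f :* M)) :- H :* M)
               refl (+ p k) (+ f) (+ h k) (+ M) ⟩
    + p k * - (+ f * + M) - + h k * + M
      ≡⟨ cong (λ z → + p k * - z - + h k * + M) (ℤₚ.pos-* f M) ⟨
    + p k * aOf ks T - + h k * + MOf ks T
      ∎
    where
    open ≡-Reasoning
    T = t k
    f = fOf ks T
    M = MOf ks T

  aOf*2^i : ∀ ks {s} → s < r → aOf ks (suc s) * + 2 ^ suc s ≡ + MOf ks (suc s) - + MOf ks s
  aOf*2^i ks {s} s<r = begin
    - + (f ℕ.* M) * + Q
      ≡⟨ cong (λ z → - z * + Q) (ℤₚ.pos-* f M) ⟩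
    - (+ f * + M) * + Q
      ≡⟨ solve 3 (λ f M Q → :- (f :* M) :* Q := :- (f :* Q :* M)) refl (+ f) (+ M) (+ Q) ⟩
    - (+ f * + Q * + M)
      ≡⟨ cong (λ z → - (z * + M)) (trans (sym (ℤₚ.pos-* f Q)) (cong +_ (fOf*2^i≡mOf-1 ks i))) ⟩
    - (+ (m ∸ 1) * + M)
      ≡⟨ solve 2 (λ u M → :- (u :* M) := M :- (u :+ con (+ 1)) :* M) refl (+ (m ∸ 1)) (+ M) ⟩
    + M - (+ (m ∸ 1) + + 1) * + M
      ≡⟨ cong (λ z → + M - z * + M) (trans (sym (ℤₚ.pos-+ (m ∸ 1) 1)) (cong +_ (ℕₚ.m∸n+n≡m (1≤mOf ks i)))) ⟩
    + M - + m * + M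
      ≡⟨ cong (λ z → + M - z) (trans (sym (ℤₚ.pos-* m M)) (cong +_ (sym (MOf-step ks s<r)))) ⟩
    + M - + MOf ks s
      ∎
    where
    open ≡-Reasoning
    i = suc s
    f = fOf ks i
    M = MOf ks i
    m = mOf ks i
    Q = 2 ^ i

  ∑<-aOf*2^i : ∀ ks {T} → T ≤ r →
    ∑< r (λ j → 𝟙 (j <? T) * (aOf ks (suc j) * + 2 ^ suc j)) ≡ + MOf ks T - + a₀Of ks
  ∑<-aOf*2^i ks {T} T≤r = begin
    ∑< r (λ j → 𝟙 (j <? T) * (aOf ks (suc j) * + 2 ^ suc j))
      ≡⟨ ∑<-𝟙< r T _ T≤r ⟩
    ∑< T (λ j → aOf ks (suc j) * + 2 ^ suc j)
      ≡⟨ ∑<-cong T (λ j j<T → aOf*2^i ks (ℕₚ.<-≤-trans j<T T≤r)) ⟩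
    ∑< T (λ j → + MOf ks (suc j) - + MOf ks j)
      ≡⟨ ∑<-telescope T (λ j → + MOf ks j) ⟩
    + MOf ks T - + MOf ks 0
      ≡⟨ cong (λ z → + MOf ks T - + z) (MOf-0 ks) ⟩
    + MOf ks T - + a₀Of ks
      ∎
    where open ≡-Reasoning

  p≡h*2^t+1 : ∀ k → + p k ≡ + h k * + 2 ^ t k + + 1
  p≡h*2^t+1 k = begin
    + p k                       ≡⟨ cong +_ (ℕₚ.m∸n+n≡m (1≤p k)) ⟨
    + (p k ∸ 1 ℕ.+ 1)           ≡⟨ ℤₚ.pos-+ (p k ∸ 1) 1 ⟩
    + (p k ∸ 1) + + 1           ≡⟨ cong (λ z → + z + + 1) (h*2^t≡p-1 k) ⟨
    + (h k ℕ.* 2 ^ t k) + + 1   ≡⟨ cong (_+ + 1) (ℤₚ.pos-* (h k) (2 ^ t k)) ⟩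
    + h k * + 2 ^ t k + + 1     ∎
    where open ≡-Reasoning

  open CyclicGroupRing r

  εOf : List (Fin n) → ℕ
  εOf ks = length (filter (λ k → h k % 2 ℕ.≟ 1) ks)

  subgroupTerms : List (Fin n) → ℕ → ℤ
  subgroupTerms ks x = ∑< r (λ j → aOf ks (suc j) * 𝟙⟨ suc j ⟩ x)

  -- The coefficients of A σ^ε + Σᵢ aᵢ Σ⟨2^i⟩ formed from the primes listed in ks.
  Φ : List (Fin n) → ℕ → ℤ
  Φ ks x = + a₀Of ks * δ (σ^ (εOf ks)) x + subgroupTerms ks x

  aOf-recurrence-at : ∀ k ks {x} i → 1 ≤ i → i ≤ r → x < N →
    + p k * (aOf ks i * 𝟙⟨ i ⟩ x) + - + h k * (aOf ks i * (𝟙⟨ t k ⟩ ⋆ 𝟙⟨ i ⟩) x)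
      ≡ aOf (k ∷ ks) i * 𝟙⟨ i ⟩ x
        + - + h k * 𝟙⟨ t k ⟩ x * (𝟙 (i ≤? t k) * (aOf ks i * + 2 ^ i))
        + 𝟙 (i ℕ.≟ t k) * (+ h k * + MOf ks (t k) * 𝟙⟨ t k ⟩ x)
  aOf-recurrence-at k ks {x} i 1≤i i≤r x<N with ℕₚ.<-cmp i (t k)
  ... | tri< i<T _ _
    rewrite 𝟙⟨⟩⋆𝟙⟨⟩-≤ (ℕₚ.<⇒≤ i<T) (t≤r k) x<N | aOf-∷-< k ks i<T
          | 𝟙-yes (i ≤? t k) (ℕₚ.<⇒≤ i<T) | 𝟙-no (i ℕ.≟ t k) (ℕₚ.<⇒≢ i<T) =
    solve 7 (λ P H a S Q Sₜ M →
                P :* (a :* S) :+ (:- H) :* (a :* (Q :* Sₜ))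
             := P :* a :* S :+ (:- H) :* Sₜ :* (con (+ 1) :* (a :* Q)) :+ con (+ 0) :* (H :* M :* Sₜ))
            refl (+ p k) (+ h k) (aOf ks i) (𝟙⟨ i ⟩ x) (+ 2 ^ i) (𝟙⟨ t k ⟩ x) (+ MOf ks (t k))
  ... | tri≈ _ refl _
    rewrite 𝟙⟨⟩⋆𝟙⟨⟩-≤ ℕₚ.≤-refl (t≤r k) x<N | aOf-∷-≡ k ks
          | 𝟙-yes (i ≤? i) ℕₚ.≤-refl | 𝟙-yes (i ℕ.≟ i) refl =
    solve 6 (λ P H a M S Q →
                P :* (a :* S) :+ (:- H) :* (a :* (Q :* S))
             := (P :* a :- H :* M) :* S :+ (:- H) :* S :* (con (+ 1) :* (a :* Q)) :+ con (+ 1) :* (H :* M :* S))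
            refl (+ p k) (+ h k) (aOf ks i) (+ MOf ks i) (𝟙⟨ i ⟩ x) (+ 2 ^ i)
  ... | tri> _ _ T<i
    rewrite 𝟙⟨⟩⋆𝟙⟨⟩-≥ x (ℕₚ.<⇒≤ T<i) i≤r | aOf-∷-> k ks T<i
          | 𝟙-no (i ≤? t k) (ℕₚ.<⇒≱ T<i) | 𝟙-no (i ℕ.≟ t k) (ℕₚ.>⇒≢ T<i) =
    trans (cong (λ P → P * (aOf ks i * 𝟙⟨ i ⟩ x) + - + h k * (aOf ks i * (+ 2 ^ t k * 𝟙⟨ i ⟩ x))) (p≡h*2^t+1 k))
          (solve 6 (λ H Q a S Sₜ M →
                       (H :* Q :+ con (+ 1)) :* (a :* S) :+ (:- H) :* (a :* (Q :* S))
                    := a :* S :+ (:- H) :* Sₜ :* con (+ 0) :+ con (+ 0) :* (H :* M :* Sₜ))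
                 refl (+ h k) (+ 2 ^ t k) (aOf ks i) (𝟙⟨ i ⟩ x) (𝟙⟨ t k ⟩ x) (+ MOf ks (t k)))

  aOf-recurrence : ∀ k ks {x} → x < N →
    + p k * subgroupTerms ks x
      + - + h k * (+ a₀Of ks * 𝟙⟨ t k ⟩ x + ∑< r (λ j → aOf ks (suc j) * (𝟙⟨ t k ⟩ ⋆ 𝟙⟨ suc j ⟩) x))
      ≡ subgroupTerms (k ∷ ks) x
  aOf-recurrence k ks {x} x<N = begin
    P * ∑< r (λ j → a j * S j) + - H * (A * Sₜ + ∑< r (λ j → a j * K j))
      ≡⟨ cong₂ _+_ (*-distribˡ-∑< r P _)
                   (trans (ℤₚ.*-distribˡ-+ (- H) _ _) (cong (λ z → - H * (A * Sₜ) + z) (*-distribˡ-∑< r (- H) _))) ⟩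
    ∑< r (λ j → P * (a j * S j)) + (- H * (A * Sₜ) + ∑< r (λ j → - H * (a j * K j)))
      ≡⟨ solve 3 (λ u v w → u :+ (v :+ w) := (u :+ w) :+ v) refl
           (∑< r (λ j → P * (a j * S j))) (- H * (A * Sₜ)) (∑< r (λ j → - H * (a j * K j))) ⟩
    ∑< r (λ j → P * (a j * S j)) + ∑< r (λ j → - H * (a j * K j)) + - H * (A * Sₜ)
      ≡⟨ cong (_+ - H * (A * Sₜ)) (sym (∑<-distrib-+ r _ _)) ⟩
    ∑< r (λ j → P * (a j * S j) + - H * (a j * K j)) + - H * (A * Sₜ)
      ≡⟨ cong (_+ - H * (A * Sₜ)) (∑<-cong r (λ j j<r → aOf-recurrence-at k ks (suc j) (s≤s z≤n) j<r x<N)) ⟩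
    ∑< r (λ j → a′ j * S j + - H * Sₜ * (𝟙 (j <? T) * (a j * Q j)) + 𝟙 (suc j ℕ.≟ T) * W) + - H * (A * Sₜ)
      ≡⟨ cong (_+ - H * (A * Sₜ))
              (trans (∑<-distrib-+ r _ _) (cong (_+ ∑< r (λ j → 𝟙 (suc j ℕ.≟ T) * W)) (∑<-distrib-+ r _ _))) ⟩
    ∑< r (λ j → a′ j * S j) + ∑< r (λ j → - H * Sₜ * (𝟙 (j <? T) * (a j * Q j)))
      + ∑< r (λ j → 𝟙 (suc j ℕ.≟ T) * W) + - H * (A * Sₜ)
      ≡⟨ cong (λ z → z + - H * (A * Sₜ)) (cong₂ (λ u v → subgroupTerms (k ∷ ks) x + u + v)
           (trans (sym (*-distribˡ-∑< r (- H * Sₜ) _)) (cong (- H * Sₜ *_) (∑<-aOf*2^i ks (t≤r k))))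
           (∑<-𝟙≟suc r T (λ _ → W) (1≤t k) (t≤r k))) ⟩
    subgroupTerms (k ∷ ks) x + - H * Sₜ * (M - A) + W + - H * (A * Sₜ)
      ≡⟨ solve 5 (λ Σ H Sₜ M A → Σ :+ (:- H) :* Sₜ :* (M :- A) :+ H :* M :* Sₜ :+ (:- H) :* (A :* Sₜ) := Σ)
               refl (subgroupTerms (k ∷ ks) x) H Sₜ M A ⟩
    subgroupTerms (k ∷ ks) x
      ∎
    where
    open ≡-Reasoning
    P = + p k
    H = + h k
    T = t k
    A = + a₀Of ks
    M = + MOf ks T
    Sₜ = 𝟙⟨ T ⟩ x
    W = H * M * Sₜ
    a a′ S K Q : ℕ → ℤ
    a j = aOf ks (suc j)
    a′ j = aOf (k ∷ ks) (suc j)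
    S j = 𝟙⟨ suc j ⟩ x
    K j = (𝟙⟨ T ⟩ ⋆ 𝟙⟨ suc j ⟩) x
    Q j = + 2 ^ suc j

  δ⋆Φ : ∀ ks {x y} → x < N → y ∈⟨σ⟩ →
    (δ y ⋆ Φ ks) x ≡ + a₀Of ks * δ ((y ℕ.+ σ^ (εOf ks)) % N) x + subgroupTerms ks x
  δ⋆Φ ks {x} {y} x<N y∈⟨σ⟩@(y<N , _) = trans (δ⋆ (Φ ks) x y<N) (cong₂ (λ u v → + a₀Of ks * u + v)
    (𝟙-⇔ (x⊖y≡c⇔x≡[y+c]%N x<N y<N (proj₁ (σ^∈⟨σ⟩ e))) (x ⊖ y ℕ.≟ σ^ e) (x ℕ.≟ (y ℕ.+ σ^ e) % N))
    (∑<-cong r (λ j _ → cong (aOf ks (suc j) *_) (𝟙⟨⟩-⊖-∈⟨σ⟩ x (s≤s z≤n) y∈⟨σ⟩))))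
    where e = εOf ks

  𝟙⟨⟩⋆Φ : ∀ ks {i x} → 1 ≤ i → x < N →
    (𝟙⟨ i ⟩ ⋆ Φ ks) x ≡ + a₀Of ks * 𝟙⟨ i ⟩ x + ∑< r (λ j → aOf ks (suc j) * (𝟙⟨ i ⟩ ⋆ 𝟙⟨ suc j ⟩) x)
  𝟙⟨⟩⋆Φ ks {i} {x} 1≤i x<N =
    trans (⋆-linearʳ 𝟙⟨ i ⟩ (δ c) (+ a₀Of ks) r (aOf ks ∘ suc) (𝟙⟨_⟩ ∘ suc) x)
          (cong (λ z → + a₀Of ks * z + ∑< r (λ j → aOf ks (suc j) * (𝟙⟨ i ⟩ ⋆ 𝟙⟨ suc j ⟩) x))
                (trans (⋆δ 𝟙⟨ i ⟩ x<N (proj₁ c∈⟨σ⟩)) (𝟙⟨⟩-⊖-∈⟨σ⟩ x 1≤i c∈⟨σ⟩)))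
    where
    c = σ^ (εOf ks)
    c∈⟨σ⟩ = σ^∈⟨σ⟩ (εOf ks)

  residueY' : Fin n → ℕ
  residueY' k = if isOdd (h k) then σ else 0 % N

  residueY'∈⟨σ⟩ : ∀ k → residueY' k ∈⟨σ⟩
  residueY'∈⟨σ⟩ k with isOdd (h k)
  ... | true  = σ∈⟨σ⟩
  ... | false = 0∈⟨σ⟩

  Y'-represents : ∀ k → Y' k represents δ (residueY' k)
  Y'-represents k with isOdd (h k)
  ... | true  = λ _ → refl
  ... | false = λ _ → refl

  σ^-εOf-∷ : ∀ k ks → σ^ (εOf (k ∷ ks)) ≡ (residueY' k ℕ.+ σ^ (εOf ks)) % N
  σ^-εOf-∷ k ks = byParity (h k % 2 ℕ.≟ 1)
    where
    e = εOf ks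
    residueY'≡ : ∀ {b} → isOdd (h k) ≡ b → residueY' k ≡ (if b then σ else 0 % N)
    residueY'≡ refl = refl
    byParity : Dec (h k % 2 ≡ 1) → σ^ (εOf (k ∷ ks)) ≡ (residueY' k ℕ.+ σ^ e) % N
    byParity (yes odd) rewrite filter-accept (λ k → h k % 2 ℕ.≟ 1) {x = k} {xs = ks} odd
                             | residueY'≡ (dec-true (h k % 2 ℕ.≟ 1) odd) = refl
    byParity (no even) rewrite filter-reject (λ k → h k % 2 ℕ.≟ 1) {x = k} {xs = ks} even
                             | residueY'≡ (dec-false (h k % 2 ℕ.≟ 1) even) =
      sym (trans ([m%N+k]%N≡[m+k]%N 0 (σ^ e)) (m<n⇒m%n≡m (proj₁ (σ^∈⟨σ⟩ e))))

  factor : Fin n → ZG r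
  factor k = ((+ p k) · Y' k) ⊕ ((- (+ h k)) · SigmaSub r (t k))

  factorCoeff : Fin n → ℕ → ℤ
  factorCoeff k a = + p k * δ (residueY' k) a + - + h k * 𝟙⟨ t k ⟩ a

  factor-represents : ∀ k → factor k represents factorCoeff k
  factor-represents k g = cong (λ z → + p k * z + - + h k * 𝟙⟨ t k ⟩ (toℕ g)) (Y'-represents k g)

  factor⋆Φ : ∀ k ks {x} → x < N → (factorCoeff k ⋆ Φ ks) x ≡ Φ (k ∷ ks) x
  factor⋆Φ k ks {x} x<N = begin
    (factorCoeff k ⋆ Φ ks) x
      ≡⟨ ⋆-linearˡ P (- H) (δ (residueY' k)) 𝟙⟨ t k ⟩ (Φ ks) x ⟩
    P * (δ (residueY' k) ⋆ Φ ks) x + - H * (𝟙⟨ t k ⟩ ⋆ Φ ks) x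
      ≡⟨ cong₂ (λ u v → P * u + - H * v) (δ⋆Φ ks x<N (residueY'∈⟨σ⟩ k)) (𝟙⟨⟩⋆Φ ks (1≤t k) x<N) ⟩
    P * (A * D + Σ) + - H * (A * Sₜ + ∑K)
      ≡⟨ solve 6 (λ P H A D Σ B → P :* (A :* D :+ Σ) :+ (:- H) :* B := P :* A :* D :+ (P :* Σ :+ (:- H) :* B))
               refl P H A D Σ (A * Sₜ + ∑K) ⟩
    P * A * D + (P * Σ + - H * (A * Sₜ + ∑K))
      ≡⟨ cong₂ _+_ (cong₂ _*_ (sym (ℤₚ.pos-* (p k) (a₀Of ks))) (cong (λ c → δ c x) (sym (σ^-εOf-∷ k ks))))
                   (aOf-recurrence k ks x<N) ⟩
    Φ (k ∷ ks) x
      ∎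
    where
    open ≡-Reasoning
    P = + p k
    H = + h k
    A = + a₀Of ks
    D = δ ((residueY' k ℕ.+ σ^ (εOf ks)) % N) x
    Σ = subgroupTerms ks x
    Sₜ = 𝟙⟨ t k ⟩ x
    ∑K = ∑< r (λ j → aOf ks (suc j) * (𝟙⟨ t k ⟩ ⋆ 𝟙⟨ suc j ⟩) x)

  prodG-factor-represents : ∀ ks → prodG (map factor ks) represents Φ ks
  prodG-factor-represents []       g = sym (begin
    + 1 * δ (0 % N) x + ∑< r (λ j → aOf [] (suc j) * 𝟙⟨ suc j ⟩ x)
      ≡⟨ cong₂ _+_ (ℤₚ.*-identityˡ (δ (0 % N) x)) (∑<-cong r (λ j _ → cong (_* 𝟙⟨ suc j ⟩ x) (aOf-[] (suc j)))) ⟩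
    δ (0 % N) x + ∑< r (λ _ → + 0)
      ≡⟨ cong (λ z → δ (0 % N) x + z) (∑<-zero r) ⟩
    δ (0 % N) x + + 0
      ≡⟨ ℤₚ.+-identityʳ _ ⟩
    δ (0 % N) x
      ∎)
    where
    open ≡-Reasoning
    x = toℕ g
  prodG-factor-represents (k ∷ ks) g =
    trans (⊛-represents {X = factorCoeff k} {Y = Φ ks} (factor-represents k) (prodG-factor-represents ks) g)
          (factor⋆Φ k ks (toℕ<n g))

  RHS-represents : Ramification.RHS r n p t represents Φ (allFin n)
  RHS-represents g = cong₂ _+_ (cong (+ a₀Of (allFin n) *_) (powG-σ-represents (εOf (allFin n)) g))
                              (sumℤ-range1 r (λ i → aOf (allFin n) i * 𝟙⟨ i ⟩ (toℕ g)))

  LHS≈RHS : Ramification.LHS r n p t ≈G Ramification.RHS r n p t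
  LHS≈RHS g = trans (prodG-factor-represents (allFin n) g) (sym (RHS-represents g))

lemma3p10 : (r : ℕ) → 1 ≤ r → (n : ℕ) → (p t : Fin n → ℕ)
    → Injective _≡_ _≡_ p
    → (∀ k → Prime (p k))
    → (∀ k → 1 ≤ t k)
    → (∀ k → t k ≤ r)
    → (∀ k → 2 ^ t k ∣ p k ∸ 1)
    → Ramification.LHS r n p t ≈G Ramification.RHS r n p t
lemma3p10 r _ n p t _ prime 1≤t t≤r 2^t∣p-1 = RamifiedProduct.LHS≈RHS r n p t 1≤p 1≤t t≤r 2^t∣p-1
  where
  1≤p : ∀ k → 1 ≤ p k
  1≤p k = ℕ.>-nonZero⁻¹ (p k) ⦃ prime⇒nonZero (prime k) ⦄
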